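{- Let $p$ be a prime and $m\in\mathbb{N}$. Let $\boldsymbol{\eta}=(\eta_j)_{0\le j<p^m}$ be non-negative integers with $\eta_0=0$ and $\eta_j\le\eta_{j+1}\le\eta_j+1$ for all $0\le j\le p^m-2$, and let $\boldsymbol{u}=(u_j)_{0\le j<p^m}$ be integers in $\{0,\ldots,p-1\}$ with $u_j\not\equiv 0\pmod p$ for all $j$. Consider the $p^m\times p^m$ matrix $P=(p_{i,j})_{0\le i,j<p^m}$ with $p_{i,j}=\binom{i+j-\eta_j}{j}u_j$, taken modulo $p$. Then: (1) In the case $\eta_j=0$ and $u_j=1$ for all $j$: $p_{0,j}=p_{i,0}=1$ for all $i,j$; $p_{i,j}\equiv 0\pmod p$ whenever $i+j\ge p^m$; and $p_{i,j}\not\equiv 0\pmod p$ whenever $i+j=p^m-1$ (i.e. $P$ modulo $p$ is an upper anti-diagonal triangular matrix with $1$'s in the first row and first column and with all anti-diagonal entries nonzero). (2) For every $t\in\{1,\ldots,p^m\}$ and every integer $l\ge 0$ with $l+t\le p^m$, the $t\times t$ submatrix $\left(\binom{i+j-\eta_j}{j}u_j\right)_{i=l,\ldots,l+t-1,\ j=0,\ldots,t-1}$ is invertible modulo $p$. (3) For every $t\in\{1,\ldots,p^m\}$ and every integer $l\ge 0$ with $l+t\le p^m$, the $t\times t$ submatrix $\left(\binom{i+j-\eta_j}{j}u_j\right)_{i=\eta_l,\ldots,\eta_l+t-1,\ j=l,\ldots,l+t-1}$ is invertible modulo $p$.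
   Context: Binomial coefficients $\binom{n}{r}$ with $n\ge0$ are taken to be $0$ when $r>n$. -}

module Defs where

open import Data.Nat using (ℕ; zero; suc; _+_; _*_; _∸_)
open import Data.Nat.Combinatorics using (_C_)
open import Data.Fin using (Fin; toℕ)
import Data.Fin as F
open import Data.Integer using (ℤ; +_; _-_)
import Data.Integer.Divisibility as ℤD
open import Data.Product using (Σ; _×_)
open import Relation.Nullary using (Dec; yes; no)

_≡_[mod_] : ℕ → ℕ → ℕ → Set
a ≡ b [mod p ] = (+ p) ℤD.∣ ((+ a) - (+ b))

sumFin : (t : ℕ) → (Fin t → ℕ) → ℕ
sumFin zero    f = 0
sumFin (suc t) f = f F.zero + sumFin t (λ j → f (F.suc j))

δ : {t : ℕ} → Fin t → Fin t → ℕ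
δ i k with i F.≟ k
... | yes _ = 1
... | no  _ = 0

_⊗_ : {t : ℕ} → (Fin t → Fin t → ℕ) → (Fin t → Fin t → ℕ) → Fin t → Fin t → ℕ
_⊗_ {t} A B i k = sumFin t (λ j → A i j * B j k)

InvertibleMod : (p t : ℕ) → (Fin t → Fin t → ℕ) → Set
InvertibleMod p t A =
  Σ (Fin t → Fin t → ℕ) λ B →
    ((i k : Fin t) → (A ⊗ B) i k ≡ δ i k [mod p ]) ×
    ((i k : Fin t) → (B ⊗ A) i k ≡ δ i k [mod p ])

entry : (η u : ℕ → ℕ) → ℕ → ℕ → ℕ
entry η u i j = ((i + j ∸ η j) C j) * u j

sub2 : (η u : ℕ → ℕ) (l t : ℕ) → Fin t → Fin t → ℕ
sub2 η u l t a b = entry η u (l + toℕ a) (toℕ b)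

sub3 : (η u : ℕ → ℕ) (l t : ℕ) → Fin t → Fin t → ℕ
sub3 η u l t a b = entry η u (η l + toℕ a) (l + toℕ b)

{-# OPTIONS --safe #-}
module Submission where

-- Modulo p, the row q = p ^ m of Pascal's triangle reads 1, 0, …, 0, 1 (the absorption
-- identity k C(q, k) = q C(q − 1, k − 1) forces p ∣ C(q, k) for 0 < k < q), so Pascal's rule
-- gives C(q + r, j) ≡ C(r, j) for j < q, and C(q − 1, j) ≢ 0 by induction on j: this is (1).
-- For (2) and (3), Vandermonde's identity factors the submatrix, exactly over ℕ, into the
-- binomial matrix (C(a, k)) and triangular matrices of shifted binomials C(y, j − k) whose
-- diagonal entries are 1 or u_j: (2) is (C(a, k)) · (C(l + b − η_b, b − k) u_b) and (3) is
-- (C(a, k)) · (C(l, k − r)) · (C(b − (η_{l+b} − η_l), b − r) u_{l+b}), where the slow growth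
-- of η makes the row indices match. Triangular matrices with unit diagonal are invertible over
-- any commutative ring, here ℕ modulo p, in which every u_j is a unit by Bézout.

open import Algebra.Bundles using (CommutativeRing)
open import Data.Fin using (Fin; zero; suc; toℕ)
open import Data.Nat.Base using (ℕ; zero; suc; _<_; s≤s; z≤n)
open import Data.Product using (Σ; ∃; _×_; _,_)
open import Data.Vec.Functional using (Vector)
open import Function using (_∘_)
open import Level using (0ℓ; _⊔_)
open import Relation.Binary.PropositionalEquality.Core as ≡ using (_≡_; _≢_)
open import Relation.Nullary using (contradiction)
open import Defs

-- Matrices over a commutative ring

module Matrices {c ℓ} (R : CommutativeRing c ℓ) where
  open CommutativeRing R hiding (zero)
  open import Algebra.Properties.Ring ring using (-‿distribˡ-*)
  open import Algebra.Properties.Semiring.Sum semiring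
  open import Relation.Binary.Reasoning.Setoid setoid

  Matrix : ℕ → Set c
  Matrix t = Fin t → Fin t → Carrier

  infix 4 _≋_
  _≋_ : ∀ {t} → Matrix t → Matrix t → Set ℓ
  A ≋ B = ∀ i k → A i k ≈ B i k

  infixl 7 _·ᵥ_ _·_
  _·ᵥ_ : ∀ {t} → Matrix t → Vector Carrier t → Vector Carrier t
  _·ᵥ_ {t} A v i = ∑[ j < t ] (A i j * v j)

  _·_ : ∀ {t} → Matrix t → Matrix t → Matrix t
  (A · B) i k = (A ·ᵥ λ j → B j k) i

  I : ∀ {t} → Matrix t
  I zero    zero    = 1#
  I zero    (suc k) = 0#
  I (suc i) zero    = 0#
  I (suc i) (suc k) = I i k

  I-diagonal : ∀ {t} (i : Fin t) → I i i ≡ 1#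
  I-diagonal zero    = ≡.refl
  I-diagonal (suc i) = I-diagonal i

  I-offDiagonal : ∀ {t} {i k : Fin t} → i ≢ k → I i k ≡ 0#
  I-offDiagonal {i = zero}  {zero}  i≢k = contradiction ≡.refl i≢k
  I-offDiagonal {i = zero}  {suc k} _   = ≡.refl
  I-offDiagonal {i = suc i} {zero}  _   = ≡.refl
  I-offDiagonal {i = suc i} {suc k} i≢k = I-offDiagonal (i≢k ∘ ≡.cong suc)

  infix 10 _ᵀ
  _ᵀ : ∀ {t} → Matrix t → Matrix t
  (A ᵀ) i k = A k i

  Invertible : ∀ {t} → Matrix t → Set (c ⊔ ℓ)
  Invertible {t} A = Σ (Matrix t) λ B → A · B ≋ I × B · A ≋ I

  ∑-zeroˡ : ∀ {t} (f : Vector Carrier t) → ∑[ j < t ] (0# * f j) ≈ 0#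
  ∑-zeroˡ f = trans (sym (*-distribˡ-sum 0# f)) (zeroˡ _)

  ·ᵥ-cong : ∀ {t} {A B : Matrix t} {v w : Vector Carrier t} →
            A ≋ B → (∀ j → v j ≈ w j) → ∀ i → (A ·ᵥ v) i ≈ (B ·ᵥ w) i
  ·ᵥ-cong A≋B v≈w i = sum-cong-≋ λ j → *-cong (A≋B i j) (v≈w j)

  ·ᵥ-*ʳ : ∀ {t} (A : Matrix t) (v : Vector Carrier t) s i →
          (A ·ᵥ λ j → v j * s) i ≈ (A ·ᵥ v) i * s
  ·ᵥ-*ʳ A v s i = trans (sum-cong-≋ λ j → sym (*-assoc (A i j) (v j) s))
                        (sym (*-distribʳ-sum s λ j → A i j * v j))

  ·ᵥ-assoc : ∀ {t} (A B : Matrix t) (v : Vector Carrier t) i →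
             ((A · B) ·ᵥ v) i ≈ (A ·ᵥ (B ·ᵥ v)) i
  ·ᵥ-assoc {t} A B v i = begin
    ∑[ j < t ] ((∑[ r < t ] (A i r * B r j)) * v j)
      ≈⟨ sum-cong-≋ (λ j → *-distribʳ-sum (v j) (λ r → A i r * B r j)) ⟩
    ∑[ j < t ] ∑[ r < t ] (A i r * B r j * v j)
      ≈⟨ ∑-comm (λ j r → A i r * B r j * v j) ⟩
    ∑[ r < t ] ∑[ j < t ] (A i r * B r j * v j)
      ≈⟨ sum-cong-≋ (λ r → sum-cong-≋ λ j → *-assoc (A i r) (B r j) (v j)) ⟩
    ∑[ r < t ] ∑[ j < t ] (A i r * (B r j * v j))
      ≈⟨ sum-cong-≋ (λ r → *-distribˡ-sum (A i r) (λ j → B r j * v j)) ⟨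
    ∑[ r < t ] (A i r * (B ·ᵥ v) r) ∎

  ·ᵥ-identityˡ : ∀ {t} (v : Vector Carrier t) i → (I ·ᵥ v) i ≈ v i
  ·ᵥ-identityˡ v zero = begin
    1# * v zero + ∑[ j < _ ] (0# * v (suc j)) ≈⟨ +-cong (*-identityˡ _) (∑-zeroˡ λ j → v (suc j)) ⟩
    v zero + 0#                             ≈⟨ +-identityʳ _ ⟩
    v zero                                  ∎
  ·ᵥ-identityˡ v (suc i) = begin
    0# * v zero + (I ·ᵥ (λ j → v (suc j))) i ≈⟨ +-cong (zeroˡ _) (·ᵥ-identityˡ (λ j → v (suc j)) i) ⟩
    0# + v (suc i)                          ≈⟨ +-identityˡ _ ⟩
    v (suc i)                               ∎

  ·-cong : ∀ {t} {A A′ B B′ : Matrix t} → A ≋ A′ → B ≋ B′ → A · B ≋ A′ · B′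
  ·-cong A≋A′ B≋B′ i k = ·ᵥ-cong A≋A′ (λ j → B≋B′ j k) i

  ·-assoc : ∀ {t} (A B C : Matrix t) → (A · B) · C ≋ A · (B · C)
  ·-assoc A B C i k = ·ᵥ-assoc A B (λ j → C j k) i

  ·-identityˡ : ∀ {t} (A : Matrix t) → I · A ≋ A
  ·-identityˡ A i k = ·ᵥ-identityˡ (λ j → A j k) i

  ≋-trans : ∀ {t} {A B C : Matrix t} → A ≋ B → B ≋ C → A ≋ C
  ≋-trans A≋B B≋C i k = trans (A≋B i k) (B≋C i k)

  ≋-sym : ∀ {t} {A B : Matrix t} → A ≋ B → B ≋ A
  ≋-sym A≋B i k = sym (A≋B i k)

  Invertible-resp-≋ : ∀ {t} {A A′ : Matrix t} → A ≋ A′ → Invertible A → Invertible A′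
  Invertible-resp-≋ A≋A′ (B , AB≋I , BA≋I) =
    B , ≋-trans (·-cong (≋-sym A≋A′) (λ _ _ → refl)) AB≋I
      , ≋-trans (·-cong (λ _ _ → refl) (≋-sym A≋A′)) BA≋I

  private
    inverse-· : ∀ {t} {A B A′ B′ : Matrix t} → A · A′ ≋ I → B · B′ ≋ I → (A · B) · (B′ · A′) ≋ I
    inverse-· {A = A} {B} {A′} {B′} AA′≋I BB′≋I =
      ≋-trans (·-assoc A B (B′ · A′))
      (≋-trans (·-cong (λ _ _ → refl) (≋-sym (·-assoc B B′ A′)))
      (≋-trans (·-cong (λ _ _ → refl) (·-cong BB′≋I (λ _ _ → refl)))
      (≋-trans (·-cong (λ _ _ → refl) (·-identityˡ A′)) AA′≋I)))

  Invertible-· : ∀ {t} {A B : Matrix t} → Invertible A → Invertible B → Invertible (A · B)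
  Invertible-· (A′ , AA′≋I , A′A≋I) (B′ , BB′≋I , B′B≋I) =
    B′ · A′ , inverse-· AA′≋I BB′≋I , inverse-· B′B≋I A′A≋I

  ᵀ-·-ᵀ : ∀ {t} (A B : Matrix t) → A ᵀ · B ᵀ ≋ (B · A) ᵀ
  ᵀ-·-ᵀ A B i k = sum-cong-≋ λ j → *-comm (A j i) (B k j)

  I-symmetric : ∀ {t} → I {t} ᵀ ≋ I
  I-symmetric zero    zero    = refl
  I-symmetric zero    (suc k) = refl
  I-symmetric (suc i) zero    = refl
  I-symmetric (suc i) (suc k) = I-symmetric i k

  Invertible-ᵀ : ∀ {t} {A : Matrix t} → Invertible (A ᵀ) → Invertible A
  Invertible-ᵀ {A = A} (B , AᵀB≋I , BAᵀ≋I) =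
    B ᵀ , ≋-trans (ᵀ-·-ᵀ (A ᵀ) B) (λ i k → trans (BAᵀ≋I k i) (I-symmetric i k))
        , ≋-trans (ᵀ-·-ᵀ B (A ᵀ)) (λ i k → trans (AᵀB≋I k i) (I-symmetric i k))

  IsUnit : Carrier → Set (c ⊔ ℓ)
  IsUnit x = ∃ λ y → x * y ≈ 1#

  lowerBlock : ∀ {t} → Carrier → Vector Carrier t → Matrix t → Matrix (suc t)
  lowerBlock a c D zero    zero    = a
  lowerBlock a c D zero    (suc k) = 0#
  lowerBlock a c D (suc i) zero    = c i
  lowerBlock a c D (suc i) (suc k) = D i k

  lowerBlock-cong : ∀ {t} {a a′} {c c′ : Vector Carrier t} {D D′ : Matrix t} →
                    a ≈ a′ → (∀ i → c i ≈ c′ i) → D ≋ D′ → lowerBlock a c D ≋ lowerBlock a′ c′ D′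
  lowerBlock-cong a≈a′ c≈c′ D≋D′ zero    zero    = a≈a′
  lowerBlock-cong a≈a′ c≈c′ D≋D′ zero    (suc k) = refl
  lowerBlock-cong a≈a′ c≈c′ D≋D′ (suc i) zero    = c≈c′ i
  lowerBlock-cong a≈a′ c≈c′ D≋D′ (suc i) (suc k) = D≋D′ i k

  lowerBlock-I : ∀ {t} → lowerBlock 1# (λ _ → 0#) I ≋ I {suc t}
  lowerBlock-I zero    zero    = refl
  lowerBlock-I zero    (suc k) = refl
  lowerBlock-I (suc i) zero    = refl
  lowerBlock-I (suc i) (suc k) = refl

  lowerBlock-· : ∀ {t} a b (c e : Vector Carrier t) (D E : Matrix t) →
                 lowerBlock a c D · lowerBlock b e E ≋
                 lowerBlock (a * b) (λ i → c i * b + (D ·ᵥ e) i) (D · E)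
  lowerBlock-· a b c e D E zero zero = trans (+-congˡ (∑-zeroˡ e)) (+-identityʳ _)
  lowerBlock-· a b c e D E zero (suc k) =
    trans (+-cong (zeroʳ a) (∑-zeroˡ λ j → E j k)) (+-identityʳ 0#)
  lowerBlock-· a b c e D E (suc i) zero = refl
  lowerBlock-· a b c e D E (suc i) (suc k) = trans (+-congʳ (zeroʳ (c i))) (+-identityˡ _)

  lowerBlock-invertible : ∀ {t} {a} (c : Vector Carrier t) {D : Matrix t} →
                          IsUnit a → Invertible D → Invertible (lowerBlock a c D)
  -- (a 0; c D)⁻¹ = (α 0; − D⁻¹ c α  D⁻¹), where a α ≈ 1.
  lowerBlock-invertible {a = a} c {D} (α , aα≈1) (D⁻¹ , DD⁻¹≋I , D⁻¹D≋I) =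
    lowerBlock α e D⁻¹ ,
    ≋-trans (lowerBlock-· a α c e D D⁻¹)
      (≋-trans (lowerBlock-cong aα≈1 left-corner DD⁻¹≋I) lowerBlock-I) ,
    ≋-trans (lowerBlock-· α a e c D⁻¹ D)
      (≋-trans (lowerBlock-cong (trans (*-comm α a) aα≈1) right-corner D⁻¹D≋I) lowerBlock-I)
    where
    x : Vector Carrier _
    x = D⁻¹ ·ᵥ c
    e : Vector Carrier _
    e i = x i * - α
    left-corner : ∀ i → c i * α + (D ·ᵥ e) i ≈ 0#
    left-corner i = begin
      c i * α + (D ·ᵥ e) i                ≈⟨ +-congˡ (·ᵥ-*ʳ D x (- α) i) ⟩
      c i * α + (D ·ᵥ x) i * - α          ≈⟨ +-congˡ (*-congʳ (sym (·ᵥ-assoc D D⁻¹ c i))) ⟩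
      c i * α + ((D · D⁻¹) ·ᵥ c) i * - α  ≈⟨ +-congˡ (*-congʳ DD⁻¹c≈c) ⟩
      c i * α + c i * - α                 ≈⟨ distribˡ (c i) α (- α) ⟨
      c i * (α + - α)                     ≈⟨ *-congˡ (-‿inverseʳ α) ⟩
      c i * 0#                            ≈⟨ zeroʳ (c i) ⟩
      0#                                  ∎
      where
      DD⁻¹c≈c : ((D · D⁻¹) ·ᵥ c) i ≈ c i
      DD⁻¹c≈c = trans (·ᵥ-cong DD⁻¹≋I (λ _ → refl) i) (·ᵥ-identityˡ c i)
    right-corner : ∀ i → e i * a + x i ≈ 0#
    right-corner i = begin
      x i * - α * a + x i           ≈⟨ +-congʳ (*-assoc (x i) (- α) a) ⟩
      x i * (- α * a) + x i         ≈⟨ +-congʳ (*-congˡ (sym (-‿distribˡ-* α a))) ⟩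
      x i * - (α * a) + x i         ≈⟨ +-congʳ (*-congˡ (-‿cong (trans (*-comm α a) aα≈1))) ⟩
      x i * - 1# + x i              ≈⟨ +-congˡ (*-identityʳ (x i)) ⟨
      x i * - 1# + x i * 1#         ≈⟨ distribˡ (x i) (- 1#) 1# ⟨
      x i * (- 1# + 1#)             ≈⟨ *-congˡ (-‿inverseˡ 1#) ⟩
      x i * 0#                      ≈⟨ zeroʳ (x i) ⟩
      0#                            ∎

  LowerTriangular : ∀ {t} → Matrix t → Set ℓ
  LowerTriangular A = ∀ i k → toℕ i < toℕ k → A i k ≈ 0#

  lowerTriangular⇒invertible : ∀ {t} {A : Matrix t} →
    LowerTriangular A → (∀ i → IsUnit (A i i)) → Invertible A
  lowerTriangular⇒invertible {zero} _ _ = (λ ()) , (λ ()) , (λ ())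
  lowerTriangular⇒invertible {suc t} {A} A-lower A-units =
    Invertible-resp-≋ A≋block
      (lowerBlock-invertible (λ i → A (suc i) zero) (A-units zero)
        (lowerTriangular⇒invertible (λ i k i<k → A-lower (suc i) (suc k) (s≤s i<k))
                                    (λ i → A-units (suc i))))
    where
    A≋block : lowerBlock (A zero zero) (λ i → A (suc i) zero) (λ i k → A (suc i) (suc k)) ≋ A
    A≋block zero    zero    = refl
    A≋block zero    (suc k) = sym (A-lower zero (suc k) (s≤s z≤n))
    A≋block (suc i) zero    = refl
    A≋block (suc i) (suc k) = refl

  upperTriangular⇒invertible : ∀ {t} {A : Matrix t} →
    LowerTriangular (A ᵀ) → (∀ i → IsUnit (A i i)) → Invertible A
  upperTriangular⇒invertible Aᵀ-lower A-units =
    Invertible-ᵀ (lowerTriangular⇒invertible Aᵀ-lower A-units)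

-- Arithmetic modulo n

open import Data.Fin.Properties using (toℕ<n)
import Data.Fin as Fin
open import Data.Integer as ℤ using (ℤ)
import Data.Integer.Properties as ℤ
import Data.Integer.Divisibility.Signed as ℤ∣
import Data.Integer.Tactic.RingSolver as ℤ-Solver
open import Data.Nat.Base using (_+_; _*_; _∸_; _^_; _≤_; _≥_; pred; NonZero; nonTrivial⇒≢1)
open import Data.Nat.Combinatorics using (_C_; nCn≡1; nC1≡n; k>n⇒nCk≡0; nCk+nC[k+1]≡[n+1]C[k+1])
open import Data.Nat.Coprimality using (coprime-Bézout; prime⇒coprime)
open import Data.Nat.Divisibility
  using (_∣_; _∣?_; _∣0; divides; ∣-trans; m∣m*n; n∣m*n; ∣⇒≤; *-monoʳ-∣; *-cancelˡ-∣; ∣1⇒≡1; ∣m+n∣m⇒∣n)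
import Data.Nat.GCD as GCD
open import Data.Nat.Primality using (Prime; prime⇒nonZero; prime⇒nonTrivial; euclidsLemma)
open import Data.Nat.Properties
open import Algebra.Properties.Semiring.Sum +-*-semiring
  using (sum-cong-≗; ∑-distrib-+; *-distribʳ-sum; sum-syntax)
import Data.Nat.Tactic.RingSolver as ℕ-Solver
open import Data.Sum using (_⊎_; inj₁; inj₂)
import Data.Sum as Sum
open import Relation.Binary.Bundles using (Setoid)
import Relation.Binary.Reasoning.Setoid as SetoidReasoning
open import Relation.Binary.PropositionalEquality
  using (refl; sym; trans; cong; cong₂; subst; subst₂; module ≡-Reasoning)
open import Relation.Nullary using (¬_; yes; no)

-- _≡_[mod_] unfolds to a divisibility of absolute values, from which Agda cannot
-- recover a and b; this wrapper keeps them inferable.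
infix 4 _≈_[mod_]
record _≈_[mod_] (a b n : ℕ) : Set where
  constructor mk≈
  field ≡[mod] : a ≡ b [mod n ]
open _≈_[mod_] public

module _ {n : ℕ} where

  private
    n∣⇒≈ : ∀ {z : ℤ} {a b} → ℤ.+ n ℤ∣.∣ z → z ≡ ℤ.+ a ℤ.- ℤ.+ b → a ≈ b [mod n ]
    n∣⇒≈ n∣z z≡ = mk≈ (ℤ∣.∣⇒∣ᵤ (subst (ℤ.+ n ℤ∣.∣_) z≡ n∣z))

    ≈⇒n∣ : ∀ {a b} → a ≈ b [mod n ] → ℤ.+ n ℤ∣.∣ (ℤ.+ a ℤ.- ℤ.+ b)
    ≈⇒n∣ a≈b = ℤ∣.∣ᵤ⇒∣ (≡[mod] a≈b)

    neg-minus : ∀ x y → ℤ.- (x ℤ.- y) ≡ y ℤ.- x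
    neg-minus = ℤ-Solver.solve-∀

    minus-+ : ∀ a b c d → (a ℤ.- b) ℤ.+ (c ℤ.- d) ≡ (a ℤ.+ c) ℤ.- (b ℤ.+ d)
    minus-+ = ℤ-Solver.solve-∀

    minus-* : ∀ a b c d → (a ℤ.- b) ℤ.* c ℤ.+ b ℤ.* (c ℤ.- d) ≡ a ℤ.* c ℤ.- b ℤ.* d
    minus-* = ℤ-Solver.solve-∀

  ≡⇒≈ : ∀ {a b} → a ≡ b → a ≈ b [mod n ]
  ≡⇒≈ {a} refl = n∣⇒≈ (ℤ∣.divides (ℤ.+ 0) refl) (sym (ℤ.+-inverseʳ (ℤ.+ a)))

  ≈-sym : ∀ {a b} → a ≈ b [mod n ] → b ≈ a [mod n ]
  ≈-sym {a} {b} a≈b = n∣⇒≈ (ℤ∣.∣m⇒∣-m (≈⇒n∣ a≈b)) (neg-minus (ℤ.+ a) (ℤ.+ b))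

  ≈-trans : ∀ {a b c} → a ≈ b [mod n ] → b ≈ c [mod n ] → a ≈ c [mod n ]
  ≈-trans {a} {b} {c} a≈b b≈c =
    n∣⇒≈ (ℤ∣.∣m∣n⇒∣m+n (≈⇒n∣ a≈b) (≈⇒n∣ b≈c)) (ℤ.+-minus-telescope (ℤ.+ a) (ℤ.+ b) (ℤ.+ c))

  ≈-+ : ∀ {a b c d} → a ≈ b [mod n ] → c ≈ d [mod n ] → a + c ≈ b + d [mod n ]
  ≈-+ {a} {b} {c} {d} a≈b c≈d =
    n∣⇒≈ (ℤ∣.∣m∣n⇒∣m+n (≈⇒n∣ a≈b) (≈⇒n∣ c≈d))
      (trans (minus-+ (ℤ.+ a) (ℤ.+ b) (ℤ.+ c) (ℤ.+ d))
             (sym (cong₂ ℤ._-_ (ℤ.pos-+ a c) (ℤ.pos-+ b d))))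

  ≈-* : ∀ {a b c d} → a ≈ b [mod n ] → c ≈ d [mod n ] → a * c ≈ b * d [mod n ]
  ≈-* {a} {b} {c} {d} a≈b c≈d =
    n∣⇒≈ (ℤ∣.∣m∣n⇒∣m+n (ℤ∣.∣m⇒∣m*n (ℤ.+ c) (≈⇒n∣ a≈b)) (ℤ∣.∣n⇒∣m*n (ℤ.+ b) (≈⇒n∣ c≈d)))
      (trans (minus-* (ℤ.+ a) (ℤ.+ b) (ℤ.+ c) (ℤ.+ d))
             (sym (cong₂ ℤ._-_ (ℤ.pos-* a c) (ℤ.pos-* b d))))

  ∣⇒≈0 : ∀ {a} → n ∣ a → a ≈ 0 [mod n ]
  ∣⇒≈0 {a} (divides q a≡qn) =
    n∣⇒≈ (ℤ∣.divides (ℤ.+ q) (trans (cong ℤ.+_ a≡qn) (ℤ.pos-* q n)))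
         (cong ℤ.+_ (sym (+-identityʳ a)))

  ≈0⇒∣ : ∀ {a} → a ≈ 0 [mod n ] → n ∣ a
  ≈0⇒∣ {a} a≈0 = subst (n ∣_) (+-identityʳ a) (≡[mod] a≈0)

≈-setoid : ℕ → Setoid 0ℓ 0ℓ
≈-setoid n = record
  { Carrier = ℕ
  ; _≈_ = _≈_[mod n ]
  ; isEquivalence = record { refl = ≡⇒≈ refl ; sym = ≈-sym ; trans = ≈-trans }
  }

module ≈-Reasoning {n : ℕ} = SetoidReasoning (≈-setoid n)

module _ (n : ℕ) .{{_ : NonZero n}} where

  -- Negation is multiplication by n - 1, so that the ring lives on ℕ itself.
  private
    -_ : ℕ → ℕ
    - x = (n ∸ 1) * x

    -‿inverseˡ : ∀ x → - x + x ≈ 0 [mod n ]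
    -‿inverseˡ x = subst (_≈ 0 [mod n ]) x*n≡-x+x (∣⇒≈0 (n∣m*n x))
      where
      open ≡-Reasoning
      x*n≡-x+x : x * n ≡ - x + x
      x*n≡-x+x = begin
        x * n             ≡⟨ *-comm x n ⟩
        n * x             ≡⟨ cong (_* x) (suc-pred n) ⟨
        x + (n ∸ 1) * x   ≡⟨ +-comm x _ ⟩
        (n ∸ 1) * x + x   ∎

  ℕ/_ : CommutativeRing 0ℓ 0ℓ
  ℕ/_ = record
    { Carrier = ℕ
    ; _≈_ = _≈_[mod n ]
    ; _+_ = _+_
    ; _*_ = _*_
    ; -_ = -_
    ; 0# = 0
    ; 1# = 1
    ; isCommutativeRing = record
      { isRing = record
        { +-isAbelianGroup = record
          { isGroup = record
            { isMonoid = record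
              { isSemigroup = record
                { isMagma = record
                  { isEquivalence = Setoid.isEquivalence (≈-setoid n)
                  ; ∙-cong = ≈-+
                  }
                ; assoc = λ x y z → ≡⇒≈ (+-assoc x y z)
                }
              ; identity = (λ x → ≡⇒≈ (+-identityˡ x)) , (λ x → ≡⇒≈ (+-identityʳ x))
              }
            ; inverse = -‿inverseˡ , (λ x → ≈-trans (≡⇒≈ (+-comm x (- x))) (-‿inverseˡ x))
            ; ⁻¹-cong = ≈-* (≡⇒≈ {a = n ∸ 1} refl)
            }
          ; comm = λ x y → ≡⇒≈ (+-comm x y)
          }
        ; *-cong = ≈-*
        ; *-assoc = λ x y z → ≡⇒≈ (*-assoc x y z)
        ; *-identity = (λ x → ≡⇒≈ (*-identityˡ x)) , (λ x → ≡⇒≈ (*-identityʳ x))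
        ; distrib = (λ x y z → ≡⇒≈ (*-distribˡ-+ x y z))
                  , (λ x y z → ≡⇒≈ (*-distribʳ-+ x y z))
        }
      ; *-comm = λ x y → ≡⇒≈ (*-comm x y)
      }
    }

-- Shifted binomial coefficients

-- C(y, j − k) for k ≤ j, and 0 (not C(y, 0), as truncated subtraction would suggest) for k > j.
infix 10 _C[_∸_]
_C[_∸_] : ℕ → ℕ → ℕ → ℕ
y C[ j     ∸ zero  ] = y C j
y C[ zero  ∸ suc k ] = 0
y C[ suc j ∸ suc k ] = y C[ j ∸ k ]

C[∸]-pascal : ∀ y j k → suc y C[ j ∸ k ] ≡ y C[ j ∸ suc k ] + y C[ j ∸ k ]
C[∸]-pascal y zero    zero    = refl
C[∸]-pascal y (suc j) zero    = sym (nCk+nC[k+1]≡[n+1]C[k+1] y j)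
C[∸]-pascal y zero    (suc k) = refl
C[∸]-pascal y (suc j) (suc k) = C[∸]-pascal y j k

j<k⇒C[j∸k]≡0 : ∀ y {j k} → j < k → y C[ j ∸ k ] ≡ 0
j<k⇒C[j∸k]≡0 y {zero}  {suc k} _         = refl
j<k⇒C[j∸k]≡0 y {suc j} {suc k} (s≤s j<k) = j<k⇒C[j∸k]≡0 y j<k

C[j∸j]≡1 : ∀ y j → y C[ j ∸ j ] ≡ 1
C[j∸j]≡1 y zero    = refl
C[j∸j]≡1 y (suc j) = C[j∸j]≡1 y j

∑-0C[j∸k] : ∀ t (f : ℕ → ℕ) j → j < t ⊎ (∀ k → t ≤ k → f k ≡ 0) →
            ∑[ k < t ] (f (toℕ k) * 0 C[ j ∸ toℕ k ]) ≡ f j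
∑-0C[j∸k] zero    f j (inj₁ ())
∑-0C[j∸k] zero    f j (inj₂ f≡0) = sym (f≡0 j z≤n)
∑-0C[j∸k] (suc t) f zero _ = begin
  f 0 * 1 + ∑[ k < t ] (f (suc (toℕ k)) * 0) ≡⟨ cong₂ _+_ (*-identityʳ (f 0)) (sym (*-distribʳ-sum {t} 0 λ k → f (suc (toℕ k)))) ⟩
  f 0 + ∑[ k < t ] f (suc (toℕ k)) * 0       ≡⟨ cong (f 0 +_) (*-zeroʳ (∑[ k < t ] f (suc (toℕ k)))) ⟩
  f 0 + 0                                    ≡⟨ +-identityʳ (f 0) ⟩
  f 0                                        ∎
  where open ≡-Reasoning
∑-0C[j∸k] (suc t) f (suc j) range =
  trans (cong (_+ ∑[ k < t ] (f (suc (toℕ k)) * 0 C[ j ∸ toℕ k ])) (*-zeroʳ (f 0)))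
        (∑-0C[j∸k] t (λ k → f (suc k)) j
           (Sum.map (λ { (s≤s j<t) → j<t }) (λ f≡0 k t≤k → f≡0 (suc k) (s≤s t≤k)) range))

vandermonde : ∀ t x y j → j < t ⊎ x < t →
              ∑[ k < t ] ((x C toℕ k) * y C[ j ∸ toℕ k ]) ≡ (x + y) C j
vandermonde t x zero j range = begin
  ∑[ k < t ] ((x C toℕ k) * 0 C[ j ∸ toℕ k ])
    ≡⟨ ∑-0C[j∸k] t (x C_) j (Sum.map₂ (λ x<t k t≤k → k>n⇒nCk≡0 (<-≤-trans x<t t≤k)) range) ⟩
  x C j
    ≡⟨ cong (_C j) (+-identityʳ x) ⟨
  (x + 0) C j ∎
  where open ≡-Reasoning
vandermonde t x (suc y) zero range = begin
  ∑[ k < t ] ((x C toℕ k) * suc y C[ 0 ∸ toℕ k ])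
    ≡⟨ sum-cong-≗ {t} (λ k → cong ((x C toℕ k) *_) (C[∸]-pascal y 0 (toℕ k))) ⟩
  ∑[ k < t ] ((x C toℕ k) * y C[ 0 ∸ toℕ k ])
    ≡⟨ vandermonde t x y 0 range ⟩
  suc (x + y) C 0
    ≡⟨ cong (_C 0) (+-suc x y) ⟨
  (x + suc y) C 0 ∎
  where open ≡-Reasoning
vandermonde t x (suc y) (suc j) range = begin
  ∑[ k < t ] ((x C toℕ k) * suc y C[ suc j ∸ toℕ k ])
    ≡⟨ sum-cong-≗ {t} (λ k → trans (cong ((x C toℕ k) *_) (C[∸]-pascal y (suc j) (toℕ k)))
                               (*-distribˡ-+ (x C toℕ k) (y C[ j ∸ toℕ k ]) (y C[ suc j ∸ toℕ k ]))) ⟩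
  ∑[ k < t ] ((x C toℕ k) * y C[ j ∸ toℕ k ] + (x C toℕ k) * y C[ suc j ∸ toℕ k ])
    ≡⟨ ∑-distrib-+ {t} (λ k → (x C toℕ k) * y C[ j ∸ toℕ k ]) _ ⟩
  ∑[ k < t ] ((x C toℕ k) * y C[ j ∸ toℕ k ]) + ∑[ k < t ] ((x C toℕ k) * y C[ suc j ∸ toℕ k ])
    ≡⟨ cong₂ _+_ (vandermonde t x y j (Sum.map₁ (<-trans (n<1+n j)) range))
                 (vandermonde t x y (suc j) range) ⟩
  (x + y) C j + (x + y) C suc j
    ≡⟨ nCk+nC[k+1]≡[n+1]C[k+1] (x + y) j ⟩
  suc (x + y) C suc j
    ≡⟨ cong (_C suc j) (+-suc x y) ⟨
  (x + suc y) C suc j ∎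
  where open ≡-Reasoning

C[∸]-convolution : ∀ t l m k b → k < t → m ≤ b →
  ∑[ r < t ] (l C[ k ∸ toℕ r ] * m C[ b ∸ toℕ r ]) ≡ (l + m) C[ l + b ∸ k ]
C[∸]-convolution t zero m k b k<t m≤b = begin
  ∑[ r < t ] (0 C[ k ∸ toℕ r ] * m C[ b ∸ toℕ r ])
    ≡⟨ sum-cong-≗ {t} (λ r → *-comm (0 C[ k ∸ toℕ r ]) _) ⟩
  ∑[ r < t ] (m C[ b ∸ toℕ r ] * 0 C[ k ∸ toℕ r ])
    ≡⟨ ∑-0C[j∸k] t (λ r → m C[ b ∸ r ]) k (inj₁ k<t) ⟩
  m C[ b ∸ k ] ∎
  where open ≡-Reasoning
C[∸]-convolution t (suc l) m zero b k<t m≤b = begin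
  ∑[ r < t ] (suc l C[ 0 ∸ toℕ r ] * m C[ b ∸ toℕ r ])
    ≡⟨ sum-cong-≗ {t} (λ r → cong (_* m C[ b ∸ toℕ r ]) (C[∸]-pascal l 0 (toℕ r))) ⟩
  ∑[ r < t ] (l C[ 0 ∸ toℕ r ] * m C[ b ∸ toℕ r ])
    ≡⟨ C[∸]-convolution t l m zero b k<t m≤b ⟩
  (l + m) C (l + b)
    ≡⟨ +-identityʳ _ ⟨
  (l + m) C (l + b) + 0
    ≡⟨ cong ((l + m) C (l + b) +_) (k>n⇒nCk≡0 (s≤s (+-monoʳ-≤ l m≤b))) ⟨
  (l + m) C (l + b) + (l + m) C suc (l + b)
    ≡⟨ nCk+nC[k+1]≡[n+1]C[k+1] (l + m) (l + b) ⟩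
  suc (l + m) C suc (l + b) ∎
  where open ≡-Reasoning
C[∸]-convolution t (suc l) m (suc k) b k<t m≤b = begin
  ∑[ r < t ] (suc l C[ suc k ∸ toℕ r ] * m C[ b ∸ toℕ r ])
    ≡⟨ sum-cong-≗ {t} (λ r → trans (cong (_* m C[ b ∸ toℕ r ]) (C[∸]-pascal l (suc k) (toℕ r)))
                               (*-distribʳ-+ (m C[ b ∸ toℕ r ]) (l C[ k ∸ toℕ r ]) (l C[ suc k ∸ toℕ r ]))) ⟩
  ∑[ r < t ] (l C[ k ∸ toℕ r ] * m C[ b ∸ toℕ r ] + l C[ suc k ∸ toℕ r ] * m C[ b ∸ toℕ r ])
    ≡⟨ ∑-distrib-+ {t} (λ r → l C[ k ∸ toℕ r ] * m C[ b ∸ toℕ r ]) _ ⟩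
  ∑[ r < t ] (l C[ k ∸ toℕ r ] * m C[ b ∸ toℕ r ]) + ∑[ r < t ] (l C[ suc k ∸ toℕ r ] * m C[ b ∸ toℕ r ])
    ≡⟨ cong₂ _+_ (C[∸]-convolution t l m k b (<-trans (n<1+n k) k<t) m≤b)
                 (C[∸]-convolution t l m (suc k) b k<t m≤b) ⟩
  (l + m) C[ l + b ∸ k ] + (l + m) C[ l + b ∸ suc k ]
    ≡⟨ +-comm ((l + m) C[ l + b ∸ k ]) _ ⟩
  (l + m) C[ l + b ∸ suc k ] + (l + m) C[ l + b ∸ k ]
    ≡⟨ C[∸]-pascal (l + m) (l + b) k ⟨
  suc (l + m) C[ l + b ∸ k ] ∎
  where open ≡-Reasoning

-- Binomial coefficients modulo a prime power

[1+k]*nC[1+k]≡n*[n-1]Ck : ∀ n k → suc k * (n C suc k) ≡ n * (pred n C k)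
[1+k]*nC[1+k]≡n*[n-1]Ck zero          k       = *-zeroʳ (suc k)
[1+k]*nC[1+k]≡n*[n-1]Ck (suc zero)    zero    = refl
[1+k]*nC[1+k]≡n*[n-1]Ck (suc zero)    (suc k) = *-zeroʳ (suc (suc k))
[1+k]*nC[1+k]≡n*[n-1]Ck (suc (suc n)) zero    =
  trans (*-identityˡ _) (trans (nC1≡n (suc (suc n))) (sym (*-identityʳ _)))
[1+k]*nC[1+k]≡n*[n-1]Ck (suc (suc n)) (suc k) = begin
  suc (suc k) * (suc (suc n) C suc (suc k))
    ≡⟨ cong (suc (suc k) *_) (nCk+nC[k+1]≡[n+1]C[k+1] (suc n) (suc k)) ⟨
  suc (suc k) * (a + b)
    ≡⟨ regroup k a b ⟩
  a + (suc k * a + suc (suc k) * b)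
    ≡⟨ cong₂ (λ x y → a + (x + y)) ([1+k]*nC[1+k]≡n*[n-1]Ck (suc n) k)
                                   ([1+k]*nC[1+k]≡n*[n-1]Ck (suc n) (suc k)) ⟩
  a + (suc n * (n C k) + suc n * (n C suc k))
    ≡⟨ cong (a +_) (*-distribˡ-+ (suc n) (n C k) _) ⟨
  a + suc n * (n C k + n C suc k)
    ≡⟨ cong (λ x → a + suc n * x) (nCk+nC[k+1]≡[n+1]C[k+1] n k) ⟩
  suc (suc n) * a ∎
  where
  open ≡-Reasoning
  a = suc n C suc k
  b = suc n C suc (suc k)
  regroup : ∀ k a b → suc (suc k) * (a + b) ≡ a + (suc k * a + suc (suc k) * b)
  regroup = ℕ-Solver.solve-∀

module _ {p : ℕ} (p-prime : Prime p) where

  p^j∣m*n⇒p∤n⇒p^j∣m : ∀ j m n → p ^ j ∣ m * n → ¬ p ∣ n → p ^ j ∣ m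
  p^j∣m*n⇒p∤n⇒p^j∣m zero    m n _ _ = divides m (sym (*-identityʳ m))
  p^j∣m*n⇒p∤n⇒p^j∣m (suc j) m n p^[1+j]∣mn p∤n
    with euclidsLemma m n p-prime (∣-trans (m∣m*n (p ^ j)) p^[1+j]∣mn)
  ... | inj₂ p∣n = contradiction p∣n p∤n
  ... | inj₁ (divides q refl) =
    subst (p ^ suc j ∣_) (*-comm p q) (*-monoʳ-∣ p (p^j∣m*n⇒p∤n⇒p^j∣m j q n p^j∣qn p∤n))
    where
    instance _ = prime⇒nonZero p-prime
    p^j∣qn : p ^ j ∣ q * n
    p^j∣qn = *-cancelˡ-∣ p (subst (p ^ suc j ∣_) (regroup q p n) p^[1+j]∣mn)
      where
      regroup : ∀ q p n → q * p * n ≡ p * (q * n)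
      regroup = ℕ-Solver.solve-∀

DividesInnerRow : ℕ → ℕ → Set
DividesInnerRow d q = ∀ k → 0 < k → k < q → d ∣ q C k

prime⇒DividesInnerRow-^ : ∀ {p} → Prime p → ∀ j → DividesInnerRow p (p ^ j)
prime⇒DividesInnerRow-^ {p} p-prime j (suc k) _ 1+k<p^j with p ∣? (p ^ j C suc k)
... | yes p∣ = p∣
... | no  p∤ = contradiction (∣⇒≤ p^j∣1+k) (<⇒≱ 1+k<p^j)
  where
  instance _ = prime⇒nonZero p-prime
  p^j∣1+k : p ^ j ∣ suc k
  p^j∣1+k = p^j∣m*n⇒p∤n⇒p^j∣m p-prime j (suc k) _
    (subst (p ^ j ∣_) (sym ([1+k]*nC[1+k]≡n*[n-1]Ck (p ^ j) k)) (m∣m*n _)) p∤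

module _ {d q : ℕ} (d∣inner : DividesInnerRow d q) where

  [q+r]Cj≈rCj : ∀ r j → j < q → (q + r) C j ≈ r C j [mod d ]
  [q+r]Cj≈rCj zero    zero    _   = ≡⇒≈ refl
  [q+r]Cj≈rCj zero    (suc k) k<q =
    subst (λ x → x C suc k ≈ 0 [mod d ]) (sym (+-identityʳ q)) (∣⇒≈0 (d∣inner (suc k) (s≤s z≤n) k<q))
  [q+r]Cj≈rCj (suc r) zero    _   = ≡⇒≈ refl
  [q+r]Cj≈rCj (suc r) (suc k) k<q = begin
    (q + suc r) C suc k                 ≡⟨ cong (_C suc k) (+-suc q r) ⟩
    suc (q + r) C suc k                 ≡⟨ nCk+nC[k+1]≡[n+1]C[k+1] (q + r) k ⟨
    (q + r) C k + (q + r) C suc k       ≈⟨ ≈-+ ([q+r]Cj≈rCj r k (<-trans (n<1+n k) k<q)) ([q+r]Cj≈rCj r (suc k) k<q) ⟩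
    r C k + r C suc k                   ≡⟨ nCk+nC[k+1]≡[n+1]C[k+1] r k ⟩
    suc r C suc k                       ∎
    where open ≈-Reasoning

  ∣[i+j]Cj : ∀ i j → i < q → j < q → q ≤ i + j → d ∣ (i + j) C j
  ∣[i+j]Cj i j i<q j<q q≤i+j = ≈0⇒∣ (begin
    (i + j) C j         ≡⟨ cong (_C j) (m+[n∸m]≡n q≤i+j) ⟨
    (q + r) C j         ≈⟨ [q+r]Cj≈rCj r j j<q ⟩
    r C j               ≡⟨ k>n⇒nCk≡0 r<j ⟩
    0                   ∎)
    where
    open ≈-Reasoning
    r = i + j ∸ q
    r<j : r < j
    r<j = +-cancelˡ-< q r j (subst (_< q + j) (sym (m+[n∸m]≡n q≤i+j)) (+-monoˡ-< j i<q))

∤nCj : ∀ {d n} → d ≢ 1 → DividesInnerRow d (suc n) → ∀ j → j ≤ n → ¬ d ∣ n C j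
∤nCj d≢1 d∣inner zero    _     d∣1 = d≢1 (∣1⇒≡1 d∣1)
∤nCj {d} {n} d≢1 d∣inner (suc k) 1+k≤n d∣nC[1+k] = ∤nCj d≢1 d∣inner k (<⇒≤ 1+k≤n)
  (∣m+n∣m⇒∣n (subst (d ∣_) (trans (sym (nCk+nC[k+1]≡[n+1]C[k+1] n k)) (+-comm (n C k) _))
                            (d∣inner (suc k) (s≤s z≤n) (s≤s 1+k≤n)))
             d∣nC[1+k])

-- The factorizations of the submatrices

module _ {N : ℕ} {η : ℕ → ℕ} where

  η[l+b]≤η[l]+b : (∀ j → suc (suc j) ≤ N → η (suc j) ≤ suc (η j)) →
                  ∀ l b → l + b < N → η (l + b) ≤ η l + b
  η[l+b]≤η[l]+b η-step l zero    _ rewrite +-identityʳ l | +-identityʳ (η l) = ≤-refl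
  η[l+b]≤η[l]+b η-step l (suc b) l+b<N rewrite +-suc l b | +-suc (η l) b =
    ≤-trans (η-step (l + b) l+b<N) (s≤s (η[l+b]≤η[l]+b η-step l b (<-trans (n<1+n _) l+b<N)))

  η[l]≤η[l+b] : (∀ j → suc (suc j) ≤ N → η j ≤ η (suc j)) →
                ∀ l b → l + b < N → η l ≤ η (l + b)
  η[l]≤η[l+b] η-mono l zero    _ rewrite +-identityʳ l = ≤-refl
  η[l]≤η[l+b] η-mono l (suc b) l+b<N rewrite +-suc l b =
    ≤-trans (η[l]≤η[l+b] η-mono l b (<-trans (n<1+n _) l+b<N)) (η-mono (l + b) l+b<N)

∑-*ʳ : ∀ t (f g : Fin t → ℕ) w → ∑[ k < t ] (f k * (g k * w)) ≡ ∑[ k < t ] (f k * g k) * w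
∑-*ʳ t f g w = trans (sum-cong-≗ {t} λ k → sym (*-assoc (f k) (g k) w))
                     (sym (*-distribʳ-sum {t} w λ k → f k * g k))

binomialMatrix : ∀ t → Fin t → Fin t → ℕ
binomialMatrix t a k = toℕ a C toℕ k

lowerC[∸]Matrix : ∀ t → ℕ → Fin t → Fin t → ℕ
lowerC[∸]Matrix t y k r = y C[ toℕ k ∸ toℕ r ]

upperC[∸]Matrix : ∀ t → (y w : ℕ → ℕ) → Fin t → Fin t → ℕ
upperC[∸]Matrix t y w k b = y (toℕ b) C[ toℕ b ∸ toℕ k ] * w (toℕ b)

sub2-factorization : ∀ {η u l t} → (∀ b → b < t → η b ≤ b) → ∀ a b →
  ∑[ k < t ] (binomialMatrix t a k * upperC[∸]Matrix t (λ j → l + (j ∸ η j)) u k b) ≡ sub2 η u l t a b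
sub2-factorization {η} {u} {l} {t} η≤id a b = begin
  ∑[ k < t ] ((toℕ a C toℕ k) * ((l + c) C[ toℕ b ∸ toℕ k ] * u (toℕ b)))
    ≡⟨ ∑-*ʳ t (binomialMatrix t a) (λ k → (l + c) C[ toℕ b ∸ toℕ k ]) (u (toℕ b)) ⟩
  ∑[ k < t ] ((toℕ a C toℕ k) * (l + c) C[ toℕ b ∸ toℕ k ]) * u (toℕ b)
    ≡⟨ cong (_* u (toℕ b)) (vandermonde t (toℕ a) (l + c) (toℕ b) (inj₁ (toℕ<n b))) ⟩
  ((toℕ a + (l + c)) C toℕ b) * u (toℕ b)
    ≡⟨ cong (λ x → (x C toℕ b) * u (toℕ b)) rows-agree ⟩
  ((l + toℕ a + toℕ b ∸ η (toℕ b)) C toℕ b) * u (toℕ b) ∎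
  where
  open ≡-Reasoning
  c = toℕ b ∸ η (toℕ b)
  rows-agree : toℕ a + (l + c) ≡ l + toℕ a + toℕ b ∸ η (toℕ b)
  rows-agree = begin
    toℕ a + (l + c)   ≡⟨ +-assoc (toℕ a) l c ⟨
    toℕ a + l + c     ≡⟨ cong (_+ c) (+-comm (toℕ a) l) ⟩
    l + toℕ a + c     ≡⟨ +-∸-assoc (l + toℕ a) (η≤id (toℕ b) (toℕ<n b)) ⟨
    l + toℕ a + toℕ b ∸ η (toℕ b) ∎

sub3-factorization : ∀ {η u l t} →
  (∀ b → b < t → η l ≤ η (l + b)) → (∀ b → b < t → η (l + b) ≤ η l + b) → ∀ a b →
  ∑[ k < t ] (binomialMatrix t a k *
              ∑[ r < t ] (lowerC[∸]Matrix t l k r *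
                          upperC[∸]Matrix t (λ j → j ∸ (η (l + j) ∸ η l)) (λ j → u (l + j)) r b))
  ≡ sub3 η u l t a b
sub3-factorization {η} {u} {l} {t} η-lower η-upper a b = begin
  ∑[ k < t ] ((toℕ a C toℕ k) * ∑[ r < t ] (l C[ toℕ k ∸ toℕ r ] * (m C[ toℕ b ∸ toℕ r ] * w)))
    ≡⟨ sum-cong-≗ {t} (λ k → cong ((toℕ a C toℕ k) *_) (column k)) ⟩
  ∑[ k < t ] ((toℕ a C toℕ k) * ((l + m) C[ l + toℕ b ∸ toℕ k ] * w))
    ≡⟨ ∑-*ʳ t (binomialMatrix t a) (λ k → (l + m) C[ l + toℕ b ∸ toℕ k ]) w ⟩
  ∑[ k < t ] ((toℕ a C toℕ k) * (l + m) C[ l + toℕ b ∸ toℕ k ]) * w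
    ≡⟨ cong (_* w) (vandermonde t (toℕ a) (l + m) (l + toℕ b) (inj₂ (toℕ<n a))) ⟩
  ((toℕ a + (l + m)) C (l + toℕ b)) * w
    ≡⟨ cong (λ x → (x C (l + toℕ b)) * w) rows-agree ⟩
  ((η l + toℕ a + (l + toℕ b) ∸ η (l + toℕ b)) C (l + toℕ b)) * w ∎
  where
  open ≡-Reasoning
  d = η (l + toℕ b) ∸ η l
  m = toℕ b ∸ d
  w = u (l + toℕ b)
  d≤b : d ≤ toℕ b
  d≤b = m≤n+o⇒m∸n≤o (η (l + toℕ b)) (η l) (η-upper (toℕ b) (toℕ<n b))
  column : ∀ k → ∑[ r < t ] (l C[ toℕ k ∸ toℕ r ] * (m C[ toℕ b ∸ toℕ r ] * w))
                 ≡ (l + m) C[ l + toℕ b ∸ toℕ k ] * w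
  column k = trans (∑-*ʳ t (lowerC[∸]Matrix t l k) (λ r → m C[ toℕ b ∸ toℕ r ]) w)
                   (cong (_* w) (C[∸]-convolution t l m (toℕ k) (toℕ b) (toℕ<n k) (m∸n≤m (toℕ b) d)))
  rows-agree : toℕ a + (l + m) ≡ η l + toℕ a + (l + toℕ b) ∸ η (l + toℕ b)
  rows-agree = begin
    toℕ a + (l + m)                            ≡⟨ cong (toℕ a +_) (+-∸-assoc l d≤b) ⟨
    toℕ a + (l + toℕ b ∸ d)                    ≡⟨ +-∸-assoc (toℕ a) (≤-trans d≤b (m≤n+m (toℕ b) l)) ⟨
    toℕ a + (l + toℕ b) ∸ d                    ≡⟨ [m+n]∸[m+o]≡n∸o (η l) (toℕ a + (l + toℕ b)) d ⟨
    η l + (toℕ a + (l + toℕ b)) ∸ (η l + d)    ≡⟨ cong₂ _∸_ (sym (+-assoc (η l) (toℕ a) _)) (m+[n∸m]≡n (η-lower (toℕ b) (toℕ<n b))) ⟩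
    η l + toℕ a + (l + toℕ b) ∸ η (l + toℕ b)  ∎

-- Invertibility modulo p

sumFin≡∑ : ∀ t (f : Fin t → ℕ) → sumFin t f ≡ ∑[ j < t ] f j
sumFin≡∑ zero    f = refl
sumFin≡∑ (suc t) f = cong (f zero +_) (sumFin≡∑ t (f ∘ suc))

module _ {p : ℕ} (p-prime : Prime p) where

  private instance
    p≢0 : NonZero p
    p≢0 = prime⇒nonZero p-prime

  open Matrices (ℕ/ p)
  private
    module ℕ/p = CommutativeRing (ℕ/ p)
    open import Algebra.Properties.Ring ℕ/p.ring using (-‿distribʳ-*; +-inverseʳ-unique; -‿involutive)

  ∤⇒IsUnit : ∀ {u} → u < p → ¬ p ∣ u → IsUnit u
  ∤⇒IsUnit {zero}      _   p∤0 = contradiction (p ∣0) p∤0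
  ∤⇒IsUnit {u@(suc _)} u<p p∤u with coprime-Bézout (prime⇒coprime p-prime u<p)
  ... | GCD.Bézout.+- x y 1+yu≡xp = ℕ/p.- y , (begin
    u * ℕ/p.- y        ≈⟨ ℕ/p.sym (-‿distribʳ-* u y) ⟩
    ℕ/p.- (u * y)      ≈⟨ ℕ/p.-‿cong (≡⇒≈ (*-comm u y)) ⟩
    ℕ/p.- (y * u)      ≈⟨ ℕ/p.-‿cong (+-inverseʳ-unique 1 (y * u) 1+yu≈0) ⟩
    ℕ/p.- (ℕ/p.- 1)    ≈⟨ -‿involutive 1 ⟩
    1                  ∎)
    where
    open ≈-Reasoning
    1+yu≈0 : 1 + y * u ≈ 0 [mod p ]
    1+yu≈0 = subst (_≈ 0 [mod p ]) (sym 1+yu≡xp) (∣⇒≈0 (n∣m*n x))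
  ... | GCD.Bézout.-+ x y 1+xp≡yu = y , (begin
    u * y              ≡⟨ *-comm u y ⟩
    y * u              ≡⟨ 1+xp≡yu ⟨
    1 + x * p          ≈⟨ ≈-+ (≡⇒≈ {a = 1} refl) (∣⇒≈0 (n∣m*n x)) ⟩
    1                  ∎)
    where open ≈-Reasoning

  δ≡I : ∀ {t} (i k : Fin t) → δ i k ≡ I i k
  δ≡I i k with i Fin.≟ k
  ... | yes refl = sym (I-diagonal i)
  ... | no  i≢k  = sym (I-offDiagonal i≢k)

  invertible⇒invertibleMod : ∀ {t} {A : Matrix t} → Invertible A → InvertibleMod p t A
  invertible⇒invertibleMod {t} {A} (B , AB≋I , BA≋I) = B , ⊗-mod A B AB≋I , ⊗-mod B A BA≋I
    where
    ⊗-mod : ∀ (C D : Matrix t) → C · D ≋ I → ∀ i k → (C ⊗ D) i k ≡ δ i k [mod p ]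
    ⊗-mod C D CD≋I i k =
      ≡[mod] (subst₂ _≈_[mod p ] (sym (sumFin≡∑ t λ j → C i j * D j k)) (sym (δ≡I i k)) (CD≋I i k))

  binomialMatrix-invertible : ∀ t → Invertible (binomialMatrix t)
  binomialMatrix-invertible t = lowerTriangular⇒invertible
    (λ a k a<k → ≡⇒≈ (k>n⇒nCk≡0 a<k))
    (λ a → 1 , ≡⇒≈ (trans (*-identityʳ _) (nCn≡1 (toℕ a))))

  lowerC[∸]Matrix-invertible : ∀ t y → Invertible (lowerC[∸]Matrix t y)
  lowerC[∸]Matrix-invertible t y = lowerTriangular⇒invertible
    (λ k r k<r → ≡⇒≈ (j<k⇒C[j∸k]≡0 y k<r))
    (λ k → 1 , ≡⇒≈ (trans (*-identityʳ _) (C[j∸j]≡1 y (toℕ k))))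

  upperC[∸]Matrix-invertible : ∀ t y w → (∀ b → b < t → IsUnit (w b)) →
                               Invertible (upperC[∸]Matrix t y w)
  upperC[∸]Matrix-invertible t y w w-units = upperTriangular⇒invertible
    (λ b k b<k → ≡⇒≈ (cong (_* w (toℕ b)) (j<k⇒C[j∸k]≡0 (y (toℕ b)) b<k)))
    (λ b → subst IsUnit (sym (diagonal b)) (w-units (toℕ b) (toℕ<n b)))
    where
    diagonal : ∀ b → y (toℕ b) C[ toℕ b ∸ toℕ b ] * w (toℕ b) ≡ w (toℕ b)
    diagonal b = trans (cong (_* w (toℕ b)) (C[j∸j]≡1 (y (toℕ b)) (toℕ b))) (*-identityˡ _)

  sub2-invertible : ∀ {η u l t} → (∀ b → b < t → η b ≤ b) → (∀ b → b < t → IsUnit (u b)) →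
                    Invertible (sub2 η u l t)
  sub2-invertible {η} {u} {l} {t} η≤id u-units =
    Invertible-resp-≋ (λ a b → ≡⇒≈ (sub2-factorization {η} {u} {l} {t} η≤id a b))
      (Invertible-· (binomialMatrix-invertible t)
        (upperC[∸]Matrix-invertible t (λ j → l + (j ∸ η j)) u u-units))

  sub3-invertible : ∀ {η u l t} →
    (∀ b → b < t → η l ≤ η (l + b)) → (∀ b → b < t → η (l + b) ≤ η l + b) →
    (∀ b → b < t → IsUnit (u (l + b))) → Invertible (sub3 η u l t)
  sub3-invertible {η} {u} {l} {t} η-lower η-upper u-units =
    Invertible-resp-≋ (λ a b → ≡⇒≈ (sub3-factorization {η} {u} {l} {t} η-lower η-upper a b))
      (Invertible-· (binomialMatrix-invertible t)
        (Invertible-· (lowerC[∸]Matrix-invertible t l)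
          (upperC[∸]Matrix-invertible t (λ j → j ∸ (η (l + j) ∸ η l)) (λ j → u (l + j)) u-units)))

  module _ {N : ℕ} {u : ℕ → ℕ} (u<p : ∀ j → j < N → u j < p) (p∤u : ∀ j → j < N → ¬ p ∣ u j)
           {t l : ℕ} (l+t≤N : l + t ≤ N) where

    private
      l+b<N : ∀ b → b < t → l + b < N
      l+b<N b b<t = <-≤-trans (+-monoʳ-< l b<t) l+t≤N

      u-unit : ∀ j → j < N → IsUnit (u j)
      u-unit j j<N = ∤⇒IsUnit (u<p j j<N) (p∤u j j<N)

    sub2-invertibleMod : ∀ {η} → η 0 ≡ 0 → (∀ j → suc (suc j) ≤ N → η (suc j) ≤ suc (η j)) →
                         InvertibleMod p t (sub2 η u l t)
    sub2-invertibleMod {η} η0≡0 η-step =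
      invertible⇒invertibleMod (sub2-invertible {η} {u} {l} {t} η≤id (λ b b<t → u-unit b (b<N b b<t)))
      where
      b<N : ∀ b → b < t → b < N
      b<N b b<t = ≤-<-trans (m≤n+m b l) (l+b<N b b<t)
      η≤id : ∀ b → b < t → η b ≤ b
      η≤id b b<t = subst (λ x → η b ≤ x + b) η0≡0 (η[l+b]≤η[l]+b η-step 0 b (b<N b b<t))

    sub3-invertibleMod : ∀ {η} → (∀ j → suc (suc j) ≤ N → η j ≤ η (suc j)) →
                         (∀ j → suc (suc j) ≤ N → η (suc j) ≤ suc (η j)) →
                         InvertibleMod p t (sub3 η u l t)
    sub3-invertibleMod {η} η-mono η-step = invertible⇒invertibleMod (sub3-invertible {η} {u} {l} {t}
      (λ b b<t → η[l]≤η[l+b] η-mono l b (l+b<N b b<t))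
      (λ b b<t → η[l+b]≤η[l]+b η-step l b (l+b<N b b<t))
      (λ b b<t → u-unit (l + b) (l+b<N b b<t)))

lemma2 : (p m : ℕ) → Prime p →
    -- (1) the case η = 0, u = 1
    (((j : ℕ) → j < p ^ m → entry (λ _ → 0) (λ _ → 1) 0 j ≡ 1 [mod p ]) ×
     ((i : ℕ) → i < p ^ m → entry (λ _ → 0) (λ _ → 1) i 0 ≡ 1 [mod p ]) ×
     ((i j : ℕ) → i < p ^ m → j < p ^ m → i + j ≥ p ^ m →
        p ∣ entry (λ _ → 0) (λ _ → 1) i j) ×
     ((i j : ℕ) → suc (i + j) ≡ p ^ m →
        ¬ (p ∣ entry (λ _ → 0) (λ _ → 1) i j))) ×
    ((η u : ℕ → ℕ) →
      η 0 ≡ 0 →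
      ((j : ℕ) → suc (suc j) ≤ p ^ m → η j ≤ η (suc j)) →
      ((j : ℕ) → suc (suc j) ≤ p ^ m → η (suc j) ≤ suc (η j)) →
      ((j : ℕ) → j < p ^ m → u j < p) →
      ((j : ℕ) → j < p ^ m → ¬ (p ∣ u j)) →
      -- (2)
      ((t l : ℕ) → 1 ≤ t → l + t ≤ p ^ m → InvertibleMod p t (sub2 η u l t)) ×
      -- (3)
      ((t l : ℕ) → 1 ≤ t → l + t ≤ p ^ m → InvertibleMod p t (sub3 η u l t)))
lemma2 p m p-prime =
  ( (λ j _ → ≡[mod] (≡⇒≈ (cong (_* 1) (nCn≡1 j))))
  , (λ i _ → ≡[mod] (≡⇒≈ {a = 1} refl))
  , (λ i j i<q j<q q≤i+j → subst (p ∣_) (sym (*-identityʳ _)) (∣[i+j]Cj inner i j i<q j<q q≤i+j))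
  , (λ i j 1+i+j≡q p∣ → ∤nCj p≢1 (subst (DividesInnerRow p) (sym 1+i+j≡q) inner) j (m≤n+m j i)
                                  (subst (p ∣_) (*-identityʳ _) p∣)) )
  , λ η u η0≡0 η-mono η-step u<p p∤u →
      (λ t l _ l+t≤q → sub2-invertibleMod p-prime u<p p∤u l+t≤q η0≡0 η-step)
    , (λ t l _ l+t≤q → sub3-invertibleMod p-prime u<p p∤u l+t≤q η-mono η-step)
  where
  inner : DividesInnerRow p (p ^ m)
  inner = prime⇒DividesInnerRow-^ p-prime m
  p≢1 : p ≢ 1
  p≢1 = nonTrivial⇒≢1 {{prime⇒nonTrivial p-prime}}
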